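{- For all positive integers $k$ and $f$, the pair $(2k, \lfloor f/k \rfloor - 2)$ is not restorable relative to $f$; that is, there exist an undirected unweighted graph $G$ and an $f$-fault replacement path in $G$ that cannot be partitioned into $2k$ consecutive subpaths which are each $(\lfloor f/k \rfloor - 2)$-fault replacement paths in $G$.
   Context: All graphs are finite, undirected and unweighted. For an integer $r$, a path $\pi$ in a graph $G=(V,E)$ is an $r$-fault replacement path if there exists a set of edges $F \subseteq E$ with $|F| \le r$ such that $\pi$ is a shortest path between its endpoints in $G \setminus F$. Relative to a value of $f$, a pair $(q, r)$ is called restorable if in every graph $G$, every $f$-fault replacement path can be partitioned into $q$ consecutive subpaths (consecutive subpaths sharing their boundary vertex) which are each $r$-fault replacement paths in $G$. -}

module Defs where

open import Data.Nat using (ℕ; zero; suc; _+_; _∸_; _≤_)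
open import Data.Integer using (ℤ; +_) renaming (_≤_ to _≤ℤ_)
open import Data.Fin using (Fin; zero; suc; fromℕ; inject₁)
open import Data.List using (List; []; _∷_; length; take; drop; head; last)
open import Data.List.Relation.Unary.All using (All)
open import Data.List.Membership.Propositional using (_∈_)
open import Data.Product using (Σ; _×_; _,_)
open import Data.Sum using (_⊎_)
open import Relation.Nullary using (¬_)
open import Relation.Binary.PropositionalEquality using (_≡_)

record Graph (n : ℕ) : Set₁ where
  field
    Adj    : Fin n → Fin n → Set
    sym    : ∀ {u v} → Adj u v → Adj v u
    irrefl : ∀ {u} → ¬ Adj u u
open Graph public

-- An edge given by its two endpoints (unordered: (u , v) and (v , u) denote the same edge).
Edge : ℕ → Set
Edge n = Fin n × Fin n

AdjMinus : ∀ {n} → Graph n → List (Edge n) → Fin n → Fin n → Set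
AdjMinus G F u v = Adj G u v × ¬ (((u , v) ∈ F) ⊎ ((v , u) ∈ F))

-- A path is a nonempty list of vertices, consecutive ones adjacent w.r.t. A.
-- Its length (number of edges) is  length π ∸ 1.
data IsWalk {n : ℕ} (A : Fin n → Fin n → Set) : List (Fin n) → Set where
  single : ∀ v → IsWalk A (v ∷ [])
  cons   : ∀ u v vs → A u v → IsWalk A (v ∷ vs) → IsWalk A (u ∷ v ∷ vs)

IsShortest : ∀ {n} → (Fin n → Fin n → Set) → List (Fin n) → Set
IsShortest A π =
  IsWalk A π ×
  (∀ π' → IsWalk A π' → head π' ≡ head π → last π' ≡ last π → length π ≤ length π')

-- π is an r-fault replacement path in G (r an integer; for r < 0 nothing qualifies).
IsFRP : ∀ {n} → Graph n → ℤ → List (Fin n) → Set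
IsFRP {n} G r π =
  Σ (List (Edge n)) λ F →
    All (λ e → Adj G (Data.Product.proj₁ e) (Data.Product.proj₂ e)) F ×
    (+ length F ≤ℤ r) ×
    IsShortest (AdjMinus G F) π

segment : ∀ {n} → ℕ → ℕ → List (Fin n) → List (Fin n)
segment i j π = take (suc (j ∸ i)) (drop i π)

-- π can be partitioned into q consecutive subpaths (sharing boundary vertices),
-- each an r-fault replacement path in G.  Breakpoints
-- 0 = b 0 ≤ b 1 ≤ … ≤ b q = |π|.
Partitionable : ∀ {n} → Graph n → ℕ → ℤ → List (Fin n) → Set
Partitionable G q r π =
  Σ (Fin (suc q) → ℕ) λ b →
    (b zero ≡ 0) ×
    (b (fromℕ q) ≡ length π ∸ 1) ×
    (∀ (j : Fin q) → b (inject₁ j) ≤ b (suc j)) ×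
    (∀ (j : Fin q) → IsFRP G r (segment (b (inject₁ j)) (b (suc j)) π))

-- Write f ≥ k d with d = ⌊f/k⌋ and put e = d − 2.  If e < 0 no path is an e-fault replacement
-- path, so a single vertex already works.  Otherwise π runs along the spine of a graph made of k
-- blocks, each with e + 2 chords from its first half to its end and flanked by e + 1 parallel
-- strands.  Deleting all k (e + 2) ≤ f chords leaves only edges that advance the layer by at most
-- one, so π becomes a shortest path.  A subpath of π that is shortest after deleting just e edges
-- cannot span the first half of a block (two chords survive, and hopping across both is a
-- shortcut), nor its second half (a chord survives; the subpath either reaches its foot directly
-- or gets back to it along a surviving strand, and the chord is a shortcut).  Hence two pieces
-- starting no later than a block end before the next block, and 2k pieces fall short of the end
-- of π.

module Submission where

open import Data.Empty using (⊥; ⊥-elim)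
open import Data.Fin using (Fin; zero; suc; toℕ; fromℕ; fromℕ<; inject₁; combine; remQuot)
open import Data.Fin.Properties
  using (toℕ-fromℕ; toℕ-inject₁; toℕ-fromℕ<; remQuot-combine; combine-remQuot)
open import Data.Integer using (ℤ; +_; _-_; +≤+; +<+)
import Data.Integer as ℤ
import Data.Integer.Properties as ℤ
open import Data.List using (List; []; _∷_; length; take; drop; head; last; map; upTo; cartesianProductWith)
open import Data.List.Properties using (length-++; length-map; length-upTo)
import Data.List.Relation.Unary.All as All
open import Data.List.Relation.Unary.Any using (here; there)
open import Data.List.Membership.Propositional using (_∈_; _∉_)
open import Data.List.Membership.Propositional.Properties
  using (∈-map⁺; ∈-upTo⁺; ∈-upTo⁻; ∈-cartesianProductWith⁺; ∈-cartesianProductWith⁻)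
open import Data.Maybe using (just)
open import Data.Maybe.Properties using (just-injective)
import Data.Nat
open import Data.Nat
  using (ℕ; zero; suc; _+_; _*_; _∸_; _/_; _≤_; _<_; z≤n; s≤s; z<s; _⊓_; _⊔_; _≟_; _≤?_; _<?_)
open import Data.Nat.DivMod using (m/n*n≤m)
open import Data.Nat.Properties
open import Data.Nat.Tactic.RingSolver using (solve-∀)
open import Data.List.Membership.DecPropositional _≟_ using (_∈?_)
open import Data.Product using (Σ; ∃; _×_; _,_; proj₁; proj₂)
open import Data.Sum using (_⊎_; inj₁; inj₂; swap)
open import Defs hiding (sym)
open import Function using (_∘_)
open import Function.Definitions using (Injective)
open import Relation.Binary.Definitions using (tri<; tri≈; tri>)
open import Relation.Binary.PropositionalEquality
open import Relation.Nullary using (¬_; yes; no)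

data Walk {n : ℕ} (A : Fin n → Fin n → Set) : Fin n → Fin n → ℕ → Set where
  ε   : ∀ {u} → Walk A u u 0
  _◅_ : ∀ {u v w ℓ} → A u v → Walk A v w ℓ → Walk A u w (suc ℓ)

infixr 5 _◅_

module _ {n : ℕ} {A : Fin n → Fin n → Set} where

  infixr 5 _◅◅_

  tailVertices : ∀ {u v ℓ} → Walk A u v ℓ → List (Fin n)
  tailVertices ε = []
  tailVertices (_◅_ {v = v} _ w) = v ∷ tailVertices w

  vertices : ∀ {u v ℓ} → Walk A u v ℓ → List (Fin n)
  vertices {u} w = u ∷ tailVertices w

  isWalk-vertices : ∀ {u v ℓ} (w : Walk A u v ℓ) → IsWalk A (vertices w)
  isWalk-vertices ε = single _
  isWalk-vertices (_◅_ {u} {v} a w) = cons u v (tailVertices w) a (isWalk-vertices w)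

  last-vertices : ∀ {u v ℓ} (w : Walk A u v ℓ) → last (vertices w) ≡ just v
  last-vertices ε = refl
  last-vertices (_ ◅ w) = last-vertices w

  length-vertices : ∀ {u v ℓ} (w : Walk A u v ℓ) → length (vertices w) ≡ suc ℓ
  length-vertices ε = refl
  length-vertices (_ ◅ w) = cong suc (length-vertices w)

  _◅◅_ : ∀ {u v w ℓ m} → Walk A u v ℓ → Walk A v w m → Walk A u w (ℓ + m)
  ε ◅◅ w = w
  (a ◅ v) ◅◅ w = a ◅ (v ◅◅ w)

  reverse : (∀ {u v} → A u v → A v u) → ∀ {u v ℓ} → Walk A u v ℓ → Walk A v u ℓ
  reverse sym ε = ε
  reverse sym {ℓ = suc ℓ} (a ◅ w) = subst (Walk A _ _) (+-comm ℓ 1) (reverse sym w ◅◅ (sym a ◅ ε))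

  shortest-≤-walk : ∀ {π u v ℓ} → IsShortest A π → head π ≡ just u → last π ≡ just v →
                    Walk A u v ℓ → length π ≤ suc ℓ
  shortest-≤-walk {π} (_ , minimal) h l w =
    subst (length π ≤_) (length-vertices w)
      (minimal (vertices w) (isWalk-vertices w) (sym h) (trans (last-vertices w) (sym l)))

  ladder : (τ : ℕ → Fin n) → ∀ {a b} → (∀ {i} → a ≤ i → i < b → A (τ i) (τ (suc i))) →
           a ≤ b → Walk A (τ a) (τ b) (b ∸ a)
  ladder τ {a} {b} edge a≤b =
    subst (λ z → Walk A (τ a) (τ z) (b ∸ a)) (m+[n∸m]≡n a≤b)
      (climb a (b ∸ a) (λ {i} a≤i i< → edge a≤i (subst (i <_) (m+[n∸m]≡n a≤b) i<)))
    where
    climb : ∀ a d → (∀ {i} → a ≤ i → i < a + d → A (τ i) (τ (suc i))) → Walk A (τ a) (τ (a + d)) d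
    climb a zero _ = subst (λ z → Walk A (τ a) (τ z) 0) (sym (+-identityʳ a)) ε
    climb a (suc d) edge′ =
      edge′ ≤-refl (m<m+n a z<s) ◅
      subst (λ z → Walk A (τ (suc a)) (τ z) d) (sym (+-suc a d))
        (climb (suc a) d (λ {i} a<i i< → edge′ (<⇒≤ a<i) (subst (i <_) (sym (+-suc a d)) i<)))

module _ {n : ℕ} (σ : ℕ → Fin n) where

  run : ℕ → ℕ → List (Fin n)
  run a zero = []
  run a (suc m) = σ a ∷ run (suc a) m

  length-run : ∀ a m → length (run a m) ≡ m
  length-run a zero = refl
  length-run a (suc m) = cong suc (length-run (suc a) m)

  last-run : ∀ a m → last (run a (suc m)) ≡ just (σ (a + m))
  last-run a zero = cong (just ∘ σ) (sym (+-identityʳ a))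
  last-run a (suc m) = trans (last-run (suc a) m) (cong (just ∘ σ) (sym (+-suc a m)))

  drop-run : ∀ i a m → drop i (run a m) ≡ run (a + i) (m ∸ i)
  drop-run zero a m = cong (λ z → run z m) (sym (+-identityʳ a))
  drop-run (suc i) a zero = refl
  drop-run (suc i) a (suc m) = trans (drop-run i (suc a) m) (cong (λ z → run z (m ∸ i)) (sym (+-suc a i)))

  take-run : ∀ t a m → t ≤ m → take t (run a m) ≡ run a t
  take-run zero a m _ = refl
  take-run (suc t) a (suc m) (s≤s t≤m) = cong (σ a ∷_) (take-run t (suc a) m t≤m)

  segment-run : ∀ {x y L} → x ≤ y → y ≤ L → segment x y (run 0 (suc L)) ≡ run x (suc (y ∸ x))
  segment-run {x} {y} {L} x≤y y≤L = begin
    take (suc (y ∸ x)) (drop x (run 0 (suc L))) ≡⟨ cong (take (suc (y ∸ x))) (drop-run x 0 (suc L)) ⟩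
    take (suc (y ∸ x)) (run x (suc L ∸ x))      ≡⟨ take-run (suc (y ∸ x)) x (suc L ∸ x) fits ⟩
    run x (suc (y ∸ x))                         ∎
    where
    open ≡-Reasoning
    fits : suc (y ∸ x) ≤ suc L ∸ x
    fits = subst (suc (y ∸ x) ≤_) (sym (+-∸-assoc 1 (≤-trans x≤y y≤L))) (s≤s (∸-monoˡ-≤ x y≤L))

  module _ {A : Fin n → Fin n → Set} where

    isWalk-run : ∀ a m → (∀ {i} → a ≤ i → i < a + m → A (σ i) (σ (suc i))) → IsWalk A (run a (suc m))
    isWalk-run a zero _ = single (σ a)
    isWalk-run a (suc m) edge =
      cons (σ a) (σ (suc a)) (run (suc (suc a)) m) (edge ≤-refl (m<m+n a z<s))
        (isWalk-run (suc a) m (λ {i} a<i i< → edge (<⇒≤ a<i) (subst (i <_) (sym (+-suc a m)) i<)))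

    run-edges : ∀ a m → IsWalk A (run a (suc m)) → ∀ {i} → a ≤ i → i < a + m → A (σ i) (σ (suc i))
    run-edges a zero _ {i} a≤i i< = ⊥-elim (<⇒≱ (subst (i <_) (+-identityʳ a) i<) a≤i)
    run-edges a (suc m) (cons _ _ _ e w) {i} a≤i i< with a ≟ i
    ... | yes refl = e
    ... | no a≢i = run-edges (suc a) m w (≤∧≢⇒< a≤i a≢i) (subst (i <_) (+-suc a m) i<)

module _ {n : ℕ} {A : Fin n → Fin n → Set} (h : Fin n → ℕ)
         (h-step : ∀ {u v} → A u v → h v ≤ suc (h u)) where

  potential-≤-length : ∀ {v vs w} → IsWalk A (v ∷ vs) → last (v ∷ vs) ≡ just w → h w ≤ h v + length vs
  potential-≤-length (single v) l = subst (λ z → h z ≤ h v + 0) (just-injective l) (m≤m+n (h v) 0)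
  potential-≤-length (cons u v vs a w) l = begin
    _                         ≤⟨ potential-≤-length w l ⟩
    h v + length vs           ≤⟨ +-monoˡ-≤ (length vs) (h-step a) ⟩
    suc (h u) + length vs     ≡⟨ sym (+-suc (h u) (length vs)) ⟩
    h u + suc (length vs)     ∎
    where open ≤-Reasoning

  shortest-by-potential : ∀ {v vs w} → IsWalk A (v ∷ vs) → last (v ∷ vs) ≡ just w →
                          h v + length vs ≤ h w → IsShortest A (v ∷ vs)
  shortest-by-potential {v} {vs} walk l climbs = walk , minimal
    where
    minimal : ∀ π → IsWalk A π → head π ≡ just v → last π ≡ last (v ∷ vs) →
              length (v ∷ vs) ≤ length π
    minimal (v′ ∷ vs′) walk′ h′ l′ rewrite just-injective h′ =
      s≤s (+-cancelˡ-≤ (h v) _ _ (≤-trans climbs (potential-≤-length walk′ (trans l′ l))))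

delete : ∀ {x : ℕ} {xs} → x ∈ xs → List ℕ
delete {xs = _ ∷ xs} (here _) = xs
delete {xs = y ∷ _} (there p) = y ∷ delete p

length-delete : ∀ {x : ℕ} {xs} (p : x ∈ xs) → suc (length (delete p)) ≡ length xs
length-delete (here _) = refl
length-delete (there p) = cong suc (length-delete p)

∈-delete : ∀ {x y : ℕ} {xs} (p : x ∈ xs) → y ∈ xs → y ≡ x ⊎ y ∈ delete p
∈-delete (here x≡z) (here y≡z) = inj₁ (trans y≡z (sym x≡z))
∈-delete (here _) (there q) = inj₂ q
∈-delete (there p) (here y≡z) = inj₂ (here y≡z)
∈-delete (there p) (there q) with ∈-delete p q
... | inj₁ y≡x = inj₁ y≡x
... | inj₂ r = inj₂ (there r)

module _ (h : ℕ → ℕ) (h-injective : Injective _≡_ _≡_ h) where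

  fresh-image : ∀ T (xs : List ℕ) → length xs < T → ∃ λ j → j < T × h j ∉ xs
  fresh-image (suc T) xs |xs|≤T with h T ∈? xs
  ... | no hT∉xs = T , ≤-refl , hT∉xs
  ... | yes hT∈xs
    with fresh-image T (delete hT∈xs) (subst (_≤ T) (sym (length-delete hT∈xs)) (≤-pred |xs|≤T))
  ...   | j , j<T , hj∉ = j , m≤n⇒m≤1+n j<T , hj∉xs
    where
    hj∉xs : h j ∉ xs
    hj∉xs hj∈xs with ∈-delete hT∈xs hj∈xs
    ... | inj₁ hj≡hT = <-irrefl (h-injective hj≡hT) j<T
    ... | inj₂ hj∈ = hj∉ hj∈

  two-fresh-images : ∀ T (xs : List ℕ) → suc (length xs) < T →
                     ∃ λ j₁ → ∃ λ j₂ → j₁ < j₂ × j₂ < T × h j₁ ∉ xs × h j₂ ∉ xs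
  two-fresh-images T xs |xs|<T with fresh-image T xs (<-trans (n<1+n _) |xs|<T)
  ... | j₁ , j₁<T , hj₁∉ with fresh-image T (h j₁ ∷ xs) |xs|<T
  ...   | j₂ , j₂<T , hj₂∉ with <-cmp j₁ j₂
  ...     | tri< j₁<j₂ _ _ = j₁ , j₂ , j₁<j₂ , j₂<T , hj₁∉ , hj₂∉ ∘ there
  ...     | tri≈ _ j₁≡j₂ _ = ⊥-elim (hj₂∉ (here (cong h (sym j₁≡j₂))))
  ...     | tri> _ _ j₂<j₁ = j₂ , j₁ , j₂<j₁ , j₁<T , hj₂∉ ∘ there , hj₁∉

module _ {n : ℕ} {F : List (Edge n)} where

  tag-∉⇒∉ : (tag : Edge n → ℕ) → ∀ {u v} → tag (v , u) ≡ tag (u , v) → tag (u , v) ∉ map tag F →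
               ¬ ((u , v) ∈ F ⊎ (v , u) ∈ F)
  tag-∉⇒∉ tag _ t∉ (inj₁ uv∈F) = t∉ (∈-map⁺ tag uv∈F)
  tag-∉⇒∉ tag t≡ t∉ (inj₂ vu∈F) = t∉ (subst (_∈ map tag F) t≡ (∈-map⁺ tag vu∈F))

  AdjMinus-sym : (G : Graph n) → ∀ {u v} → AdjMinus G F u v → AdjMinus G F v u
  AdjMinus-sym G (a , u≁v) = Graph.sym G a , u≁v ∘ swap

clamp : (q : ℕ) → ℕ → Fin (suc q)
clamp q zero = zero
clamp zero (suc m) = zero
clamp (suc q) (suc m) = suc (clamp q m)

toℕ-clamp : ∀ q {m} → m ≤ q → toℕ (clamp q m) ≡ m
toℕ-clamp q {zero} _ = refl
toℕ-clamp (suc q) {suc m} (s≤s m≤q) = cong suc (toℕ-clamp q m≤q)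

clamp-toℕ : ∀ q (i : Fin (suc q)) → clamp q (toℕ i) ≡ i
clamp-toℕ q zero = refl
clamp-toℕ (suc q) (suc i) = cong suc (clamp-toℕ q i)

module _ {n : ℕ} {G : Graph n} {q : ℕ} {r : ℤ} {π : List (Fin n)} where

  breakpoints : Partitionable G q r π →
    Σ (ℕ → ℕ) λ B → B 0 ≡ 0 × B q ≡ length π ∸ 1 ×
      (∀ {m} → m < q → B m ≤ B (suc m) × IsFRP G r (segment (B m) (B (suc m)) π))
  breakpoints (b , b₀ , b-last , b-mono , b-frp) =
    B , b₀ , trans (B-at (fromℕ q) (toℕ-fromℕ q)) b-last , piece
    where
    B : ℕ → ℕ
    B m = b (clamp q m)
    B-at : ∀ {m} (i : Fin (suc q)) → toℕ i ≡ m → B m ≡ b i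
    B-at i refl = cong b (clamp-toℕ q i)
    piece : ∀ {m} → m < q → B m ≤ B (suc m) × IsFRP G r (segment (B m) (B (suc m)) π)
    piece m<q = subst₂ (λ s t → s ≤ t × IsFRP G r (segment s t π)) (sym lower) (sym upper) (b-mono j , b-frp j)
      where
      j = fromℕ< m<q
      lower = B-at (inject₁ j) (trans (toℕ-inject₁ j) (toℕ-fromℕ< m<q))
      upper = B-at (suc j) (cong suc (toℕ-fromℕ< m<q))

module _ {q : ℕ} (B : ℕ → ℕ) (B-step : ∀ {m} → m < q → B m ≤ B (suc m)) where

  ≤-last-breakpoint : ∀ {m} → m ≤ q → B m ≤ B q
  ≤-last-breakpoint {m} m≤q = go (q ∸ m) m (m+[n∸m]≡n m≤q)
    where
    go : ∀ d m → m + d ≡ q → B m ≤ B q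
    go zero m m+0≡q = ≤-reflexive (cong B (trans (sym (+-identityʳ m)) m+0≡q))
    go (suc d) m m+d≡q = ≤-trans (B-step (subst (m <_) m+d≡q (m<m+n m z<s)))
                                 (go d (suc m) (trans (sym (+-suc m d)) m+d≡q))

2+2*m≤2*n : ∀ {m n} → m < n → 2 + 2 * m ≤ 2 * n
2+2*m≤2*n {m} {n} m<n = subst (_≤ 2 * n) (*-suc 2 m) (*-monoʳ-≤ 2 m<n)

module _ (K : ℕ) (start middle : ℕ → ℕ) (Piece : ℕ → ℕ → Set)
         (first-half-unspanned : ∀ {c x y} → c < K → x ≤ start c → middle c ≤ y → ¬ Piece x y)
         (second-half-unspanned : ∀ {c x y} → c < K → x ≤ middle c → start (suc c) ≤ y → ¬ Piece x y)
         (B : ℕ → ℕ) (B₀ : B 0 ≤ start 0) (B-pieces : ∀ {m} → m < 2 * K → Piece (B m) (B (suc m))) where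

  two-pieces-per-block : ∀ {c} → c < K → B (2 * c) ≤ start c → B (2 * suc c) < start (suc c)
  two-pieces-per-block {c} c<K B≤start rewrite *-suc 2 c with B (2 + 2 * c) <? start (suc c)
  ... | yes end< = end<
  ... | no end≮ with B (suc (2 * c)) ≤? middle c
  ...   | yes mid≤ = ⊥-elim (second-half-unspanned c<K mid≤ (≮⇒≥ end≮) (B-pieces (2+2*m≤2*n c<K)))
  ...   | no mid≰ =
    ⊥-elim (first-half-unspanned c<K B≤start (<⇒≤ (≰⇒> mid≰)) (B-pieces (<⇒≤ (2+2*m≤2*n c<K))))

  breakpoints-fall-behind : ∀ {c} → c < K → B (2 * suc c) < start (suc c)
  breakpoints-fall-behind {c} c<K = two-pieces-per-block c<K (reach c (<⇒≤ c<K))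
    where
    reach : ∀ c → c ≤ K → B (2 * c) ≤ start c
    reach zero _ = B₀
    reach (suc c) c<K = <⇒≤ (two-pieces-per-block c<K (reach c (<⇒≤ c<K)))

shortcut-shorter : ∀ {x t b y} → x + t < b → b ≤ y → t + (y ∸ b) < y ∸ x
shortcut-shorter {x} {t} {b} {y} x+t<b b≤y = +-cancelˡ-< x _ _ (begin-strict
  x + (t + (y ∸ b)) ≡⟨ +-assoc x t (y ∸ b) ⟨
  x + t + (y ∸ b)   <⟨ +-monoˡ-< (y ∸ b) x+t<b ⟩
  b + (y ∸ b)       ≡⟨ m+[n∸m]≡n b≤y ⟩
  y                 ≡⟨ m+[n∸m]≡n x≤y ⟨
  x + (y ∸ x)       ∎)
  where
  open ≤-Reasoning
  x≤y : x ≤ y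
  x≤y = ≤-trans (m≤m+n x t) (≤-trans (<⇒≤ x+t<b) b≤y)

m+[[n∸m]+o]≡n+o : ∀ {m n} o → m ≤ n → m + ((n ∸ m) + o) ≡ n + o
m+[[n∸m]+o]≡n+o {m} {n} o m≤n = trans (sym (+-assoc m (n ∸ m) o)) (cong (_+ o) (m+[n∸m]≡n m≤n))

x+[x∸a]≤s+2*t : ∀ {s a x t} → s ≤ a → a ≤ x → x ≤ s + t → x + (x ∸ a) ≤ s + 2 * t
x+[x∸a]≤s+2*t {s} {a} {x} {t} s≤a a≤x x≤s+t = +-cancelˡ-≤ a _ _ (begin
  a + (x + (x ∸ a))       ≡⟨ x+[a+[x∸a]] ⟩
  x + x                   ≤⟨ +-mono-≤ x≤s+t x≤s+t ⟩
  (s + t) + (s + t)       ≡⟨ regroup s t ⟩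
  s + (s + 2 * t)         ≤⟨ +-monoˡ-≤ (s + 2 * t) s≤a ⟩
  a + (s + 2 * t)         ∎)
  where
  open ≤-Reasoning
  x+[a+[x∸a]] : a + (x + (x ∸ a)) ≡ x + x
  x+[a+[x∸a]] = trans (+-comm a _) (trans (+-assoc x (x ∸ a) a) (cong (λ z → x + z) (m∸n+n≡m a≤x)))
  regroup : ∀ s t → (s + t) + (s + t) ≡ s + (s + 2 * t)
  regroup = solve-∀

length-cartesianProductWith : ∀ {A B C : Set} (f : A → B → C) xs ys →
                              length (cartesianProductWith f xs ys) ≡ length xs * length ys
length-cartesianProductWith f [] ys = refl
length-cartesianProductWith f (x ∷ xs) ys =
  trans (length-++ (map (f x) ys)) (cong₂ _+_ (length-map (f x) ys) (length-cartesianProductWith f xs ys))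

-- Vertex (i , s) sits on layer i ≤ L of strand s < D.  Strand 0 is the spine, which carries π;
-- the other e + 1 strands are parallel detour tracks.  Block c occupies layers c M … hi c and
-- has D chords, from lo c j (j < D, all in the first half of the block) to hi c.
module Construction (K′ e : ℕ) where

  K D : ℕ
  K = suc K′
  D = 2 + e

  -- Opaque only to keep the unifier from unfolding M inside lo and hi.
  opaque
    M : ℕ
    M = 6 * D

    M-def : M ≡ 6 * D
    M-def = refl

  L : ℕ
  L = K * M

  lo : ℕ → ℕ → ℕ
  lo c j = c * M + 3 * j

  hi : ℕ → ℕ
  hi c = suc c * M

  3j+1<M : ∀ {j} → j < D → 3 * j + 1 < M
  3j+1<M {j} j<D = begin-strict
    3 * j + 1                         ≤⟨ +-monoˡ-≤ 1 (*-monoʳ-≤ 3 (≤-pred j<D)) ⟩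
    3 * suc e + 1                     <⟨ m<m+n _ z<s ⟩
    3 * suc e + 1 + suc (3 * e + 7)   ≡⟨ M-split e ⟩
    6 * D                             ≡⟨ M-def ⟨
    M                                 ∎
    where
    open ≤-Reasoning
    M-split : ∀ e → 3 * suc e + 1 + suc (3 * e + 7) ≡ 6 * (2 + e)
    M-split = solve-∀

  lo+1<hi : ∀ c {j} → j < D → lo c j + 1 < hi c
  lo+1<hi c {j} j<D = begin-strict
    c * M + 3 * j + 1   ≡⟨ +-assoc (c * M) (3 * j) 1 ⟩
    c * M + (3 * j + 1) <⟨ +-monoʳ-< (c * M) (3j+1<M j<D) ⟩
    c * M + M           ≡⟨ +-comm (c * M) M ⟩
    hi c                ∎
    where open ≤-Reasoning

  lo≤hi : ∀ c {j} → j < D → lo c j ≤ hi c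
  lo≤hi c j<D = ≤-trans (m≤m+n _ 1) (<⇒≤ (lo+1<hi c j<D))

  hi≤L : ∀ {c} → c < K → hi c ≤ L
  hi≤L c<K = *-monoˡ-≤ M c<K

  lo≤L : ∀ {c j} → c < K → j < D → lo c j ≤ L
  lo≤L {c} c<K j<D = ≤-trans (lo≤hi c j<D) (hi≤L c<K)

  lo-gap : ∀ c {j₁ j₂} → j₁ < j₂ → lo c j₁ + 2 < lo c j₂
  lo-gap c {j₁} {j₂} j₁<j₂ = begin-strict
    c * M + 3 * j₁ + 2   ≡⟨ +-assoc (c * M) (3 * j₁) 2 ⟩
    c * M + (3 * j₁ + 2) <⟨ +-monoʳ-< (c * M) 3j₁+2<3j₂ ⟩
    c * M + 3 * j₂       ∎
    where
    open ≤-Reasoning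
    three-suc : ∀ j → 3 * suc j ≡ suc (3 * j + 2)
    three-suc = solve-∀
    3j₁+2<3j₂ : 3 * j₁ + 2 < 3 * j₂
    3j₁+2<3j₂ = subst (_≤ 3 * j₂) (three-suc j₁) (*-monoʳ-≤ 3 j₁<j₂)

  lo-injective : ∀ c → Injective _≡_ _≡_ (lo c)
  lo-injective c {j₁} {j₂} eq = *-cancelˡ-≡ j₁ j₂ 3 (+-cancelˡ-≡ (c * M) _ _ eq)

  lo≤lo-last : ∀ c {j} → j < D → lo c j ≤ lo c (suc e)
  lo≤lo-last c j<D = +-monoʳ-≤ (c * M) (*-monoʳ-≤ 3 (≤-pred j<D))

  detour-room : ∀ s → s + 2 * (3 * suc e) + 3 < M + s
  detour-room s = subst (s + 2 * (3 * suc e) + 3 <_) (trans (room-split s e) (cong (_+ s) (sym M-def)))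
                        (m<m+n _ z<s)
    where
    room-split : ∀ s e → s + 2 * (3 * suc e) + 3 + 3 ≡ 6 * (2 + e) + s
    room-split = solve-∀

  n : ℕ
  n = suc L * D

  coords : Fin n → ℕ × ℕ
  coords v = toℕ (proj₁ (remQuot {suc L} D v)) , toℕ (proj₂ (remQuot {suc L} D v))

  layer strand : Fin n → ℕ
  layer v = proj₁ (coords v)
  strand v = proj₂ (coords v)

  vertex : ℕ → ℕ → Fin n
  vertex i s = combine (clamp L i) (clamp (suc e) s)

  coords-vertex : ∀ {i s} → i ≤ L → s < D → coords (vertex i s) ≡ (i , s)
  coords-vertex {i} {s} i≤L s<D =
    trans (cong (λ (a , b) → toℕ a , toℕ b) (remQuot-combine {suc L} {D} (clamp L i) (clamp (suc e) s)))
          (cong₂ _,_ (toℕ-clamp L i≤L) (toℕ-clamp (suc e) (≤-pred s<D)))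

  vertex-coords : ∀ v → vertex (layer v) (strand v) ≡ v
  vertex-coords v = trans (cong₂ (combine {suc L} {D}) (clamp-toℕ L q) (clamp-toℕ (suc e) r))
                          (combine-remQuot {suc L} D v)
    where
    q = proj₁ (remQuot {suc L} D v)
    r = proj₂ (remQuot {suc L} D v)

  layer-vertex : ∀ {i s} → i ≤ L → s < D → layer (vertex i s) ≡ i
  layer-vertex i≤L s<D = cong proj₁ (coords-vertex i≤L s<D)

  strand-vertex : ∀ {i s} → i ≤ L → s < D → strand (vertex i s) ≡ s
  strand-vertex i≤L s<D = cong proj₂ (coords-vertex i≤L s<D)

  spine : ℕ → Fin n
  spine i = vertex i 0

  layer-spine : ∀ {i} → i ≤ L → layer (spine i) ≡ i
  layer-spine i≤L = layer-vertex i≤L z<s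

  spine-at : ∀ {u a} → coords u ≡ (a , 0) → u ≡ spine a
  spine-at {u} eq = trans (sym (vertex-coords u)) (cong (λ (a , s) → vertex a s) eq)

  data Link : ℕ × ℕ → ℕ × ℕ → Set where
    rung  : ∀ {i s} → Link (i , s) (suc i , s)
    spoke : ∀ {i s} → Link (i , 0) (i , suc s)
    chord : ∀ {c j} → c < K → j < D → Link (lo c j , 0) (hi c , 0)

  link-distinct : ∀ {p q} → Link p q → p ≢ q
  link-distinct rung p≡q = 1+n≢n (sym (cong proj₁ p≡q))
  link-distinct spoke p≡q = 0≢1+n (cong proj₂ p≡q)
  link-distinct (chord {c} c<K j<D) p≡q =
    m+1+n≰m (hi c) (<⇒≤ (subst (λ z → z + 1 < hi c) (cong proj₁ p≡q) (lo+1<hi c j<D)))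

  link-layers : ∀ {p q} → Link p q →
                (proj₁ q ≤ suc (proj₁ p) × proj₁ p ≤ suc (proj₁ q)) ⊎
                (∃ λ c → ∃ λ j → c < K × j < D × p ≡ (lo c j , 0) × q ≡ (hi c , 0))
  link-layers rung = inj₁ (≤-refl , m≤n⇒m≤1+n (n≤1+n _))
  link-layers spoke = inj₁ (n≤1+n _ , n≤1+n _)
  link-layers (chord {c} {j} c<K j<D) = inj₂ (c , j , c<K , j<D , refl , refl)

  G : Graph n
  G = record
    { Adj    = λ u v → Link (coords u) (coords v) ⊎ Link (coords v) (coords u)
    ; sym    = swap
    ; irrefl = λ { (inj₁ l) → link-distinct l refl ; (inj₂ l) → link-distinct l refl }
    }

  adj : ∀ {i s j t} → i ≤ L → j ≤ L → s < D → t < D → Link (i , s) (j , t) →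
        Adj G (vertex i s) (vertex j t)
  adj i≤L j≤L s<D t<D l = inj₁ (subst₂ Link (sym (coords-vertex i≤L s<D)) (sym (coords-vertex j≤L t<D)) l)

  chord-adjacent : ∀ {c j} → c < K → j < D → Adj G (spine (lo c j)) (spine (hi c))
  chord-adjacent c<K j<D = adj (lo≤L c<K j<D) (hi≤L c<K) z<s z<s (chord c<K j<D)

  chordEdge : ℕ → ℕ → Edge n
  chordEdge c j = spine (lo c j) , spine (hi c)

  chords : List (Edge n)
  chords = cartesianProductWith chordEdge (upTo K) (upTo D)

  length-chords : length chords ≡ K * D
  length-chords = trans (length-cartesianProductWith chordEdge (upTo K) (upTo D))
                        (cong₂ _*_ (length-upTo K) (length-upTo D))

  ∈-chords⁺ : ∀ {c j} → c < K → j < D → chordEdge c j ∈ chords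
  ∈-chords⁺ c<K j<D = ∈-cartesianProductWith⁺ chordEdge (∈-upTo⁺ c<K) (∈-upTo⁺ j<D)

  ∈-chords⁻ : ∀ {ed} → ed ∈ chords → ∃ λ c → ∃ λ j → c < K × j < D × ed ≡ chordEdge c j
  ∈-chords⁻ ed∈
    with c , j , c∈ , j∈ , refl ← ∈-cartesianProductWith⁻ chordEdge (upTo K) (upTo D) ed∈
    = c , j , ∈-upTo⁻ c∈ , ∈-upTo⁻ j∈ , refl

  ∈-chords-at : ∀ {u v c j} → c < K → j < D → coords u ≡ (lo c j , 0) → coords v ≡ (hi c , 0) →
                (u , v) ∈ chords
  ∈-chords-at c<K j<D u-at v-at =
    subst (_∈ chords) (sym (cong₂ _,_ (spine-at u-at) (spine-at v-at))) (∈-chords⁺ c<K j<D)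

  chords-long : ∀ {u v} → (u , v) ∈ chords → layer u + 1 < layer v
  chords-long uv∈ with c , j , c<K , j<D , refl ← ∈-chords⁻ uv∈ =
    subst₂ (λ a b → a + 1 < b) (sym (layer-spine (lo≤L c<K j<D))) (sym (layer-spine (hi≤L c<K)))
      (lo+1<hi c j<D)

  layer-step : ∀ {u v} → AdjMinus G chords u v → layer v ≤ suc (layer u)
  layer-step (inj₁ l , unfaulted) with link-layers l
  ... | inj₁ (up , _) = up
  ... | inj₂ (c , j , c<K , j<D , u-at , v-at) = ⊥-elim (unfaulted (inj₁ (∈-chords-at c<K j<D u-at v-at)))
  layer-step (inj₂ l , unfaulted) with link-layers l
  ... | inj₁ (_ , down) = down
  ... | inj₂ (c , j , c<K , j<D , v-at , u-at) = ⊥-elim (unfaulted (inj₂ (∈-chords-at c<K j<D v-at u-at)))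

  spine-step : ∀ {i} → i < L → AdjMinus G chords (spine i) (spine (suc i))
  spine-step {i} i<L = adj i≤L i<L z<s z<s rung , not-chord
    where
    i≤L = <⇒≤ i<L
    long : ∀ {a b} → (spine a , spine b) ∈ chords → a ≤ L → b ≤ L → a + 1 < b
    long ab∈ a≤L b≤L = subst₂ (λ a b → a + 1 < b) (layer-spine a≤L) (layer-spine b≤L) (chords-long ab∈)
    not-chord : ¬ ((spine i , spine (suc i)) ∈ chords ⊎ (spine (suc i) , spine i) ∈ chords)
    not-chord (inj₁ ∈chords) = m+1+n≰m i (≤-pred (long ∈chords i≤L i<L))
    not-chord (inj₂ ∈chords) = 1+n≰n (≤-trans (s≤s (m≤m+n i 1)) (<⇒≤ (long ∈chords i<L i≤L)))

  π : List (Fin n)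
  π = run spine 0 (suc L)

  π-shortest : IsShortest (AdjMinus G chords) π
  π-shortest = shortest-by-potential layer layer-step
    (isWalk-run spine 0 L (λ _ i<L → spine-step i<L)) (last-run spine 0 L)
    (≤-reflexive (trans (cong₂ _+_ (layer-spine z≤n) (length-run spine 1 L)) (sym (layer-spine ≤-refl))))

  π-replacement : ∀ {f} → K * D ≤ f → IsFRP G (+ f) π
  π-replacement {f} KD≤f =
    chords , All.tabulate chord-edge-adjacent , +≤+ (subst (_≤ f) (sym length-chords) KD≤f) , π-shortest
    where
    chord-edge-adjacent : ∀ {ed} → ed ∈ chords → Adj G (proj₁ ed) (proj₂ ed)
    chord-edge-adjacent ed∈ with c , j , c<K , j<D , refl ← ∈-chords⁻ ed∈ = chord-adjacent c<K j<D

  -- Fewer than D faults miss some chord, identified by its lower end, and fewer than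
  -- D − 1 faults miss some detour strand, identified by its larger strand index.
  lowerLayer upperStrand : Edge n → ℕ
  lowerLayer (u , v) = layer u ⊓ layer v
  upperStrand (u , v) = strand u ⊔ strand v

  module Segment (F : List (Edge n)) (|F|≤e : length F ≤ e) {x y : ℕ} (x≤y : x ≤ y) (y≤L : y ≤ L)
                 (shortest : IsShortest (AdjMinus G F) (run spine x (suc (y ∸ x)))) where

    A : Fin n → Fin n → Set
    A = AdjMinus G F

    no-shortcut : ∀ {ℓ} → Walk A (spine x) (spine y) ℓ → ¬ ℓ < y ∸ x
    no-shortcut {ℓ} w ℓ< =
      <⇒≱ ℓ< (≤-pred (subst (_≤ suc ℓ) (length-run spine x (suc (y ∸ x)))
                             (shortest-≤-walk shortest refl last-spine w)))
      where
      last-spine : last (run spine x (suc (y ∸ x))) ≡ just (spine y)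
      last-spine = trans (last-run spine x (y ∸ x)) (cong (just ∘ spine) (m+[n∸m]≡n x≤y))

    along : ∀ {a b} → x ≤ a → a ≤ b → b ≤ y → Walk A (spine a) (spine b) (b ∸ a)
    along x≤a a≤b b≤y = ladder spine on-π a≤b
      where
      on-π : ∀ {i} → _ ≤ i → i < _ → A (spine i) (spine (suc i))
      on-π {i} a≤i i<b = run-edges spine x (y ∸ x) (proj₁ shortest) (≤-trans x≤a a≤i)
                           (subst (i <_) (sym (m+[n∸m]≡n x≤y)) (<-≤-trans i<b b≤y))

    spine-distance : ∀ {b t} → b ≤ y → Walk A (spine x) (spine b) t → b ≤ x + t
    spine-distance b≤y w = ≮⇒≥ λ x+t<b →
      no-shortcut (w ◅◅ along (≤-trans (m≤m+n _ _) (<⇒≤ x+t<b)) b≤y ≤-refl)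
                  (shortcut-shorter x+t<b b≤y)

    untagged : (tag : Edge n → ℕ) → (∀ u v → tag (v , u) ≡ tag (u , v)) →
               ∀ {u v} → Adj G u v → tag (u , v) ∉ map tag F → A u v
    untagged tag tag-sym uv t∉ = uv , tag-∉⇒∉ tag (tag-sym _ _) t∉

    |tags|≤e : (tag : Edge n → ℕ) → length (map tag F) ≤ e
    |tags|≤e tag = subst (_≤ e) (sym (length-map tag F)) |F|≤e

    chord-step : ∀ {c j} → c < K → j < D → lo c j ∉ map lowerLayer F → A (spine (lo c j)) (spine (hi c))
    chord-step {c} {j} c<K j<D lo∉ =
      untagged lowerLayer (λ u v → ⊓-comm (layer v) (layer u)) (chord-adjacent c<K j<D)
               (subst (_∉ map lowerLayer F) (sym tag≡lo) lo∉)
      where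
      tag≡lo : lowerLayer (chordEdge c j) ≡ lo c j
      tag≡lo = trans (cong₂ _⊓_ (layer-spine (lo≤L c<K j<D)) (layer-spine (hi≤L c<K)))
                     (m≤n⇒m⊓n≡m (lo≤hi c j<D))

    strand-detour : ∀ {s a b} → s < suc e → suc s ∉ map upperStrand F → a ≤ b → b ≤ L →
                    Walk A (spine a) (spine b) (2 + (b ∸ a))
    strand-detour {s} {a} {b} s<1+e s∉ a≤b b≤L =
      subst (Walk A (spine a) (spine b)) (cong suc (+-comm (b ∸ a) 1))
        (enter (≤-trans a≤b b≤L) ◅ (ladder τ climb a≤b ◅◅ (AdjMinus-sym G (enter b≤L) ◅ ε)))
      where
      τ : ℕ → Fin n
      τ i = vertex i (suc s)
      1+s<D : suc s < D
      1+s<D = s≤s s<1+e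
      on-strand : ∀ {u v} → Adj G u v → upperStrand (u , v) ≡ suc s → A u v
      on-strand uv tag≡ = untagged upperStrand (λ u v → ⊔-comm (strand v) (strand u)) uv
                                   (subst (_∉ map upperStrand F) (sym tag≡) s∉)
      enter : ∀ {i} → i ≤ L → A (spine i) (τ i)
      enter i≤L = on-strand (adj i≤L i≤L z<s 1+s<D spoke)
                            (cong₂ _⊔_ (strand-vertex i≤L z<s) (strand-vertex i≤L 1+s<D))
      climb : ∀ {i} → a ≤ i → i < b → A (τ i) (τ (suc i))
      climb {i} _ i<b = on-strand (adj (<⇒≤ i<L) i<L 1+s<D 1+s<D rung)
                                  (trans (cong₂ _⊔_ (strand-vertex (<⇒≤ i<L) 1+s<D) (strand-vertex i<L 1+s<D))
                                         (⊔-idem (suc s)))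
        where i<L = <-≤-trans i<b b≤L

    first-half-unspanned : ∀ {c} → c < K → x ≤ c * M → lo c (suc e) ≤ y → ⊥
    first-half-unspanned {c} c<K x≤cM last≤y
      with j₁ , j₂ , j₁<j₂ , j₂<D , lo₁∉ , lo₂∉ ←
           two-fresh-images (lo c) (lo-injective c) D (map lowerLayer F) (s≤s (s≤s (|tags|≤e lowerLayer)))
      = <⇒≱ (lo-gap c j₁<j₂)
            (subst (lo c j₂ ≤_) (m+[[n∸m]+o]≡n+o 2 x≤lo₁) (spine-distance lo₂≤y hop))
      where
      j₁<D = <-trans j₁<j₂ j₂<D
      x≤lo₁ = ≤-trans x≤cM (m≤m+n _ _)
      lo₂≤y = ≤-trans (lo≤lo-last c j₂<D) last≤y
      lo₁≤y = ≤-trans (≤-trans (m≤m+n _ 2) (<⇒≤ (lo-gap c j₁<j₂))) lo₂≤y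
      hop : Walk A (spine x) (spine (lo c j₂)) ((lo c j₁ ∸ x) + 2)
      hop = along ≤-refl x≤lo₁ lo₁≤y ◅◅
            chord-step c<K j₁<D lo₁∉ ◅ AdjMinus-sym G (chord-step c<K j₂<D lo₂∉) ◅ ε

    second-half-unspanned : ∀ {c} → c < K → x ≤ lo c (suc e) → hi c ≤ y → ⊥
    second-half-unspanned {c} c<K x≤last hi≤y
      with j , j<D , lo∉ ←
           fresh-image (lo c) (lo-injective c) D (map lowerLayer F) (s≤s (m≤n⇒m≤1+n (|tags|≤e lowerLayer)))
      with x ≤? lo c j
    ... | yes x≤lo =
      <⇒≱ (lo+1<hi c j<D) (subst (hi c ≤_) (m+[[n∸m]+o]≡n+o 1 x≤lo) (spine-distance hi≤y
        (along ≤-refl x≤lo (≤-trans (lo≤hi c j<D) hi≤y) ◅◅ chord-step c<K j<D lo∉ ◅ ε)))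
    ... | no x≰lo
      with s , s<1+e , s∉ ←
           fresh-image suc suc-injective (suc e) (map upperStrand F) (s≤s (|tags|≤e upperStrand))
      = <⇒≱ back-and-forth-shorter (spine-distance hi≤y (back ◅◅ chord-step c<K j<D lo∉ ◅ ε))
      where
      lo≤x = <⇒≤ (≰⇒> x≰lo)
      cM≤lo = m≤m+n (c * M) (3 * j)
      back : Walk A (spine x) (spine (lo c j)) (2 + (x ∸ lo c j))
      back = reverse (AdjMinus-sym G) (strand-detour s<1+e s∉ lo≤x (≤-trans x≤y y≤L))
      back-and-forth-shorter : x + ((2 + (x ∸ lo c j)) + 1) < hi c
      back-and-forth-shorter = begin-strict
        x + ((2 + (x ∸ lo c j)) + 1)  ≡⟨ regroup x (x ∸ lo c j) ⟩
        x + (x ∸ lo c j) + 3          ≤⟨ +-monoˡ-≤ 3 (x+[x∸a]≤s+2*t cM≤lo lo≤x x≤last) ⟩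
        c * M + 2 * (3 * suc e) + 3   <⟨ detour-room (c * M) ⟩
        hi c                          ∎
        where
        open ≤-Reasoning
        regroup : ∀ x d → x + ((2 + d) + 1) ≡ x + d + 3
        regroup = solve-∀

  ReplacementPiece : ℕ → ℕ → Set
  ReplacementPiece x y = y ≤ L × IsFRP G (+ e) (segment x y π)

  piece-shortest : ∀ {x y} → x ≤ y → ReplacementPiece x y →
                   Σ (List (Edge n)) λ F → length F ≤ e × IsShortest (AdjMinus G F) (run spine x (suc (y ∸ x)))
  piece-shortest x≤y (y≤L , F , _ , +≤+ |F|≤e , shortest) =
    F , |F|≤e , subst (IsShortest (AdjMinus G F)) (segment-run spine x≤y y≤L) shortest

  first-half-unspanned : ∀ {c x y} → c < K → x ≤ c * M → lo c (suc e) ≤ y → ¬ ReplacementPiece x y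
  first-half-unspanned {c} c<K x≤cM last≤y piece =
    let F , |F|≤e , shortest = piece-shortest x≤y piece
    in Segment.first-half-unspanned F |F|≤e x≤y (proj₁ piece) shortest c<K x≤cM last≤y
    where x≤y = ≤-trans x≤cM (≤-trans (m≤m+n (c * M) _) last≤y)

  second-half-unspanned : ∀ {c x y} → c < K → x ≤ lo c (suc e) → suc c * M ≤ y → ¬ ReplacementPiece x y
  second-half-unspanned {c} c<K x≤last hi≤y piece =
    let F , |F|≤e , shortest = piece-shortest x≤y piece
    in Segment.second-half-unspanned F |F|≤e x≤y (proj₁ piece) shortest c<K x≤last hi≤y
    where x≤y = ≤-trans x≤last (≤-trans (lo≤hi c (n<1+n (suc e))) hi≤y)

  not-partitionable : ¬ Partitionable G (2 * K) (+ e) π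
  not-partitionable partition
    with B , B₀ , B-last , B-pieces ← breakpoints {G = G} {q = 2 * K} {r = + e} {π = π} partition
    = <-irrefl B[2K]≡L (breakpoints-fall-behind K (_* M) (λ c → lo c (suc e)) ReplacementPiece
                          first-half-unspanned second-half-unspanned B (≤-reflexive B₀) pieces ≤-refl)
    where
    B[2K]≡L : B (2 * K) ≡ L
    B[2K]≡L = trans B-last (cong (_∸ 1) (length-run spine 0 (suc L)))
    pieces : ∀ {m} → m < 2 * K → ReplacementPiece (B m) (B (suc m))
    pieces {m} m<2K = subst (B (suc m) ≤_) B[2K]≡L (≤-last-breakpoint B (proj₁ ∘ B-pieces) m<2K)
                    , proj₂ (B-pieces m<2K)

not-partitionable-below-zero : ∀ {n} {G : Graph n} {q r π} → r ℤ.< + 0 → Fin q → ¬ Partitionable G q r π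
not-partitionable-below-zero r<0 j (_ , _ , _ , _ , pieces) with _ , _ , |F|≤r , _ ← pieces j
  with +<+ () ← ℤ.≤-<-trans |F|≤r r<0

trivial-counterexample : ∀ {q r f} → r ℤ.< + 0 → Fin q →
  Σ ℕ λ n → Σ (Graph n) λ G → Σ (List (Fin n)) λ π → IsFRP G (+ f) π × ¬ Partitionable G q r π
trivial-counterexample r<0 j =
  1 , point , zero ∷ [] , trivial-replacement , not-partitionable-below-zero {G = point} {π = zero ∷ []} r<0 j
  where
  point : Graph 1
  point = record { Adj = λ _ _ → ⊥ ; sym = λ () ; irrefl = λ () }
  trivial-replacement : ∀ {f} → IsFRP point (+ f) (zero ∷ [])
  trivial-replacement = [] , All.[] , +≤+ z≤n , single zero , λ { _ (single _) _ _ → ≤-refl }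

counterexample : ∀ k′ f d → suc k′ * d ≤ f →
  Σ ℕ λ n → Σ (Graph n) λ G → Σ (List (Fin n)) λ π →
    IsFRP G (+ f) π × ¬ Partitionable G (2 * suc k′) (+ d - + 2) π
counterexample k′ f 0 _ = trivial-counterexample ℤ.-<+ zero
counterexample k′ f 1 _ = trivial-counterexample ℤ.-<+ zero
counterexample k′ f (suc (suc e)) KD≤f = n , G , π , π-replacement KD≤f , not-partitionable
  where open Construction k′ e

proposition3p2 : (k f : ℕ) → (k≠0 : Data.Nat.NonZero k) → Data.Nat.NonZero f →
    Σ ℕ λ n → Σ (Graph n) λ G → Σ (List (Fin n)) λ π →
      IsFRP G (+ f) π ×
      ¬ Partitionable G (2 * k) ((+ ((f / k) {{k≠0}})) - + 2) π
proposition3p2 (suc k′) f _ _ =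
  counterexample k′ f (f / suc k′) (subst (_≤ f) (*-comm (f / suc k′) (suc k′)) (m/n*n≤m f (suc k′)))
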